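{- If $s\ge 3$ and $n\ge 3$, then $\mu_{\rm t}(C_s\,\square\,K_n)=0$ if $s\ge 5$, and $\mu_{\rm t}(C_s\,\square\,K_n)=n$ if $s\in\{3,4\}$.
   Context: $C_s$ is the cycle on $s$ vertices and $K_n$ the complete graph on $n$ vertices. The Cartesian product $G\,\square\,H$ has vertex set $V(G)\times V(H)$, with $(g,h)$ adjacent to $(g',h')$ iff either $gg'\in E(G)$ and $h=h'$, or $g=g'$ and $hh'\in E(H)$. For a connected graph $G$ and $X\subseteq V(G)$, two vertices $x,y$ are $X$-visible if there is a shortest $x,y$-path $P$ with $V(P)\cap X\subseteq\{x,y\}$; $X$ is a total mutual-visibility set if every pair of vertices of $G$ is $X$-visible. $\mu_{\rm t}(G)$ is the largest cardinality of a total mutual-visibility set of $G$. -}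

module Defs where

open import Data.Nat using (ℕ; zero; suc; _+_; _≤_)
open import Data.Fin using (Fin; toℕ)
open import Data.Product using (Σ; _×_; ∃; ∃-syntax; _,_)
open import Data.Sum using (_⊎_)
open import Data.List using (List; []; _∷_; length)
open import Data.List.Membership.Propositional using (_∈_)
open import Data.List.Relation.Unary.Unique.Propositional using (Unique)
open import Relation.Binary.PropositionalEquality using (_≡_; _≢_)

record Graph : Set₁ where
  field
    V   : Set
    _~_ : V → V → Set

open Graph public

data Walk (G : Graph) : V G → V G → ℕ → Set where
  []  : ∀ {x} → Walk G x x 0
  _∷_ : ∀ {x y z k} → _~_ G x y → Walk G y z k → Walk G x z (suc k)

verts : ∀ {G x y k} → Walk G x y k → List (V G)
verts {x = x} []      = x ∷ []
verts {x = x} (e ∷ w) = x ∷ verts w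

-- A shortest x,y-path: a walk of length k from x to y such that every
-- x,y-walk has length at least k (such a walk is automatically a path).
IsShortest : ∀ {G x y k} → Walk G x y k → Set
IsShortest {G} {x} {y} {k} _ = ∀ m → Walk G x y m → k ≤ m

Visible : (G : Graph) → List (V G) → V G → V G → Set
Visible G X x y =
  ∃[ k ] Σ (Walk G x y k) λ P →
    IsShortest P ×
    (∀ v → v ∈ verts P → v ∈ X → (v ≡ x ⊎ v ≡ y))

-- X is a total mutual-visibility set: every pair of vertices is X-visible.
-- Finite vertex subsets are represented as duplicate-free lists.
IsTotalMutualVisibilitySet : (G : Graph) → List (V G) → Set
IsTotalMutualVisibilitySet G X = ∀ x y → Visible G X x y

MuT≡ : Graph → ℕ → Set
MuT≡ G m =
  (Σ (List (V G)) λ X → Unique X × IsTotalMutualVisibilitySet G X × length X ≡ m)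
  × (∀ X → Unique X → IsTotalMutualVisibilitySet G X → length X ≤ m)

CycNext : (s : ℕ) → Fin s → Fin s → Set
CycNext s i j = (toℕ i + 1 ≡ toℕ j) ⊎ ((toℕ i + 1 ≡ s) × (toℕ j ≡ 0))

Cycle : (s : ℕ) → Graph
Cycle s = record
  { V   = Fin s
  ; _~_ = λ i j → CycNext s i j ⊎ CycNext s j i
  }

Complete : (n : ℕ) → Graph
Complete n = record { V = Fin n ; _~_ = λ i j → i ≢ j }

_□_ : Graph → Graph → Graph
G □ H = record
  { V   = V G × V H
  ; _~_ = λ { (g , h) (g′ , h′) → (_~_ G g g′ × h ≡ h′) ⊎ (g ≡ g′ × _~_ H h h′) }
  }

-- A pair of vertices at distance two all of whose common neighbours lie in X is
-- not X-visible. In Cₛ □ Kₙ with s ≥ 5 every vertex (i,h) is the only common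
-- neighbour of (i−1,h) and (i+1,h), so only the empty set is a total
-- mutual-visibility set. For s ∈ {3,4}, members (a,h), (b,g) of X with a ~ b and
-- h ≠ g block (a,g) and (b,h); hence if two members of X share their Kₙ-coordinate
-- h, all of X lies in row h, where it has at most 3 (s = 3) resp. 2 (s = 4)
-- elements; otherwise the Kₙ-coordinates are distinct and |X| ≤ n. Conversely
-- {0} is a total mutual-visibility set of C₃ and C₄, and such a one-vertex set
-- of G lifts to the column {0} × V(Kₙ) of G □ Kₙ, of size n.
module Submission where

open import Defs
open import Data.Nat using (ℕ; zero; suc; _+_; _*_; _∸_; _≤_; _<_; z≤n; s≤s; NonZero; >-nonZero)
open import Data.Nat.Properties renaming (_≟_ to _≟ℕ_)
open import Data.Nat.Induction using (<-rec)
open import Algebra.Properties.CommutativeSemigroup +-commutativeSemigroup using (x∙yz≈y∙xz)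
open import Data.Nat.DivMod
open import Data.Fin using (Fin; zero; toℕ; fromℕ<)
open import Data.Fin.Properties using (toℕ<n; toℕ-fromℕ<; toℕ-injective)
  renaming (any? to anyFin?; all? to allFin?; _≟_ to _≟Fin_)
open import Function using (id)
open import Data.Product using (Σ; _×_; ∃; ∃₂; _,_; proj₁; proj₂)
open import Data.Sum as Sum using (_⊎_; inj₁; inj₂; [_,_])
open import Data.Empty using (⊥; ⊥-elim)
open import Data.List using (List; []; _∷_; _++_; length; map; allFin; cartesianProduct)
open import Data.List.Properties using (length-map; length-tabulate; ++-identityʳ; length-removeAt′)
open import Data.List.Membership.Propositional using (_∈_; find; lose)
open import Data.List.Membership.Propositional.Properties
  using (∈-cartesianProduct⁺; ∈-cartesianProduct⁻; ∈-allFin)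
open import Data.List.Relation.Unary.Any as Any using (here; there; _─_)
open import Data.List.Relation.Unary.All as All using ([])
import Data.List.Relation.Unary.All.Properties as AllP
open import Data.List.Relation.Unary.AllPairs using ([]; _∷_)
open import Data.List.Relation.Unary.Unique.Propositional using (Unique)
import Data.List.Relation.Unary.Unique.Propositional.Properties as Unique
open import Data.List.Relation.Binary.Subset.Propositional using (_⊆_)
open import Relation.Binary.Definitions using (DecidableEquality; Decidable)
open import Relation.Nullary using (¬_; Dec; yes; no; contradiction)
open import Relation.Nullary.Decidable using (map′; _×-dec_; _⊎-dec_; _→-dec_; ¬?; from-yes)
open import Relation.Binary.PropositionalEquality
  using (_≡_; _≢_; refl; sym; trans; cong; subst; subst₂; module ≡-Reasoning)

-- Counting duplicate-free lists

module _ {A : Set} where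

  ∈-─ : ∀ {x z : A} {ys} (x∈ys : x ∈ ys) → z ∈ ys → z ≢ x → z ∈ (ys ─ x∈ys)
  ∈-─ (here refl) (here refl) z≢x = contradiction refl z≢x
  ∈-─ (here refl) (there z∈ys) _  = z∈ys
  ∈-─ (there _)   (here refl) _   = here refl
  ∈-─ (there x∈ys) (there z∈ys) z≢x = there (∈-─ x∈ys z∈ys z≢x)

  Unique-⊆⇒length-≤ : ∀ {xs ys : List A} → Unique xs → xs ⊆ ys → length xs ≤ length ys
  Unique-⊆⇒length-≤ {[]}     _            _  = z≤n
  Unique-⊆⇒length-≤ {x ∷ xs} {ys} (x∉xs ∷ xs!) xs⊆ys =
    subst (suc (length xs) ≤_) (sym (length-removeAt′ ys _))
      (s≤s (Unique-⊆⇒length-≤ xs! λ z∈xs →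
        ∈-─ x∈ys (xs⊆ys (there z∈xs)) λ { refl → All.lookup x∉xs z∈xs refl }))
    where x∈ys = xs⊆ys (here refl)

module _ {A B : Set} (f : A → B) (_≟_ : DecidableEquality B) where

  Unique-map-or-collision : ∀ xs → Unique xs →
    Unique (map f xs) ⊎ ∃₂ λ x y → x ∈ xs × y ∈ xs × x ≢ y × f x ≡ f y
  Unique-map-or-collision []       _ = inj₁ []
  Unique-map-or-collision (x ∷ xs) (x∉xs ∷ xs!)
    with Any.any? (λ y → f x ≟ f y) xs | Unique-map-or-collision xs xs!
  ... | yes fx∈fxs | _ = let y , y∈xs , fx≡fy = find fx∈fxs in
                         inj₂ (x , y , here refl , there y∈xs , All.lookup x∉xs y∈xs , fx≡fy)
  ... | no fx∉fxs  | inj₁ fxs! = inj₁ (AllP.map⁺ (AllP.¬Any⇒All¬ xs fx∉fxs) ∷ fxs!)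
  ... | no _       | inj₂ (y , z , y∈xs , z∈xs , y≢z , fy≡fz) =
                         inj₂ (y , z , there y∈xs , there z∈xs , y≢z , fy≡fz)

module _ {A : Set} {n : ℕ} where

  length≤n-or-row-collision : (X : List (A × Fin n)) → Unique X →
    length X ≤ n ⊎ ∃₂ λ a b → ∃ λ h → a ≢ b × (a , h) ∈ X × (b , h) ∈ X
  length≤n-or-row-collision X X! with Unique-map-or-collision proj₂ _≟Fin_ X X!
  ... | inj₁ proj₂! = inj₁ (subst₂ _≤_ (length-map proj₂ X) (length-tabulate id)
                             (Unique-⊆⇒length-≤ proj₂! λ _ → ∈-allFin _))
  ... | inj₂ ((a , h) , (b , _) , a∈X , b∈X , ah≢bh , refl) =
        inj₂ (a , b , h , (λ { refl → ah≢bh refl }) , a∈X , b∈X)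

-- Geodesics and blocked pairs

module _ {G : Graph} where

  private
    _~ᴳ_ = _~_ G

  _∷ʳ_ : ∀ {x y z k} → Walk G x y k → y ~ᴳ z → Walk G x z (suc k)
  []      ∷ʳ e = e ∷ []
  (f ∷ w) ∷ʳ e = f ∷ (w ∷ʳ e)

  ∈-verts-∷ʳ : ∀ {x y z k v} (w : Walk G x y k) (e : y ~ᴳ z) →
               v ∈ verts (w ∷ʳ e) → v ∈ verts w ⊎ v ≡ z
  ∈-verts-∷ʳ []      e (here v≡x)         = inj₁ (here v≡x)
  ∈-verts-∷ʳ []      e (there (here v≡z)) = inj₂ v≡z
  ∈-verts-∷ʳ (f ∷ w) e (here v≡x)         = inj₁ (here v≡x)
  ∈-verts-∷ʳ (f ∷ w) e (there v∈)         = Sum.map₁ there (∈-verts-∷ʳ w e v∈)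

  shortest-if-no-shorter : ∀ {x y k} (w : Walk G x y k) →
                           (∀ j → j < k → ¬ Walk G x y j) → IsShortest w
  shortest-if-no-shorter w none m w′ = ≮⇒≥ λ m<k → none m m<k w′

  []-shortest : ∀ {x} → IsShortest {G} {x} {x} []
  []-shortest _ _ = z≤n

  edge-shortest : ∀ {x y} → x ≢ y → (e : x ~ᴳ y) → IsShortest (e ∷ [])
  edge-shortest x≢y e = shortest-if-no-shorter (e ∷ []) λ
    { zero    _         [] → x≢y refl
    ; (suc _) (s≤s ()) _ }

  CommonNeighbour : V G → V G → V G → Set
  CommonNeighbour u w c = u ~ᴳ c × c ~ᴳ w

  -- Every shortest u,w-path has length two and its middle vertex in P.
  Blocks : (V G → Set) → V G → V G → Set
  Blocks P u w =
    u ≢ w × ¬ u ~ᴳ w × ∃ (CommonNeighbour u w) × (∀ c → CommonNeighbour u w c → P c)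

  Dominates : V G → V G → Set
  Dominates a b = ∀ c → c ~ᴳ a ⊎ c ~ᴳ b

  TwoStepsAvoiding : V G → Set
  TwoStepsAvoiding z = ∀ a b → a ≢ b → ¬ a ~ᴳ b → ∃ λ c → CommonNeighbour a b c × c ≢ z

  Geodesic : V G → V G → Set
  Geodesic x y = ∃ λ k → Σ (Walk G x y k) IsShortest

  Blocks-mono : ∀ {P Q : V G → Set} {u w} → (∀ {c} → P c → Q c) → Blocks P u w → Blocks Q u w
  Blocks-mono P⇒Q (u≢w , u≁w , common , inP) = u≢w , u≁w , common , λ c cn → P⇒Q (inP c cn)

  Blocks⇒¬Visible : ∀ {X u w} → Blocks (_∈ X) u w → ¬ Visible G X u w
  Blocks⇒¬Visible {X} {u} {w} (u≢w , u≁w , (_ , e , f) , inX) (_ , P , P-shortest , P-avoids) =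
    no-short-avoiding-walk P P-avoids (P-shortest 2 (e ∷ f ∷ []))
    where
      no-short-avoiding-walk : ∀ {k} (P : Walk G u w k) →
        (∀ v → v ∈ verts P → v ∈ X → v ≡ u ⊎ v ≡ w) → k ≤ 2 → ⊥
      no-short-avoiding-walk []           _      _ = u≢w refl
      no-short-avoiding-walk (e ∷ [])     _      _ = u≁w e
      no-short-avoiding-walk (e ∷ f ∷ []) avoids _ with avoids _ (there (here refl)) (inX _ (e , f))
      ... | inj₁ refl = u≁w f
      ... | inj₂ refl = u≁w e
      no-short-avoiding-walk (_ ∷ _ ∷ _ ∷ _) _ (s≤s (s≤s ()))

  module _ (_≟_ : DecidableEquality (V G)) (_~?_ : Decidable _~ᴳ_) where

    module _ (vertices : List (V G)) (complete : ∀ v → v ∈ vertices) where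

      walk? : ∀ x y k → Dec (Walk G x y k)
      walk? x y zero    = map′ (λ { refl → [] }) (λ { [] → refl }) (x ≟ y)
      walk? x y (suc k) with Any.any? (λ z → (x ~? z) ×-dec walk? z y k) vertices
      ... | yes step = let _ , _ , e , w = find step in yes (e ∷ w)
      ... | no none  = no λ { (e ∷ w) → none (lose (complete _) (e , w)) }

      shortest-walk : ∀ {x y} k → Walk G x y k → Geodesic x y
      shortest-walk {x} {y} = <-rec _ step
        where
          step : ∀ k → (∀ {j} → j < k → Walk G x y j → Geodesic x y) → Walk G x y k → Geodesic x y
          step k shorter w
            with anyFin? {P = λ (j : Fin k) → Walk G x y (toℕ j)} (λ j → walk? x y (toℕ j))
          ... | yes (j , w′) = shorter (toℕ<n j) w′
          ... | no none      = k , w , shortest-if-no-shorter w λ j j<k w′ →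
                                 none (fromℕ< j<k , subst (Walk G x y) (sym (toℕ-fromℕ< j<k)) w′)

      connected⇒[]-TMV : (∀ x y → ∃ (Walk G x y)) → IsTotalMutualVisibilitySet G []
      connected⇒[]-TMV connected x y with shortest-walk _ (proj₂ (connected x y))
      ... | k , P , P-shortest = k , P , P-shortest , λ _ _ ()

    singleton-TMV : ∀ z → TwoStepsAvoiding z → IsTotalMutualVisibilitySet G (z ∷ [])
    singleton-TMV z avoidable a b with a ≟ b
    ... | yes refl = 0 , [] , []-shortest , λ { _ (here refl) _ → inj₁ refl }
    ... | no a≢b with a ~? b
    ...   | yes e = 1 , e ∷ [] , edge-shortest a≢b e , λ
      { _ (here refl)         _ → inj₁ refl
      ; _ (there (here refl)) _ → inj₂ refl }
    ...   | no a≁b with avoidable a b a≢b a≁b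
    ...     | _ , (e , f) , c≢z = 2 , e ∷ f ∷ [] , two-step-shortest , λ
      { _ (here refl)                 _          → inj₁ refl
      ; _ (there (here refl))         (here c≡z) → contradiction c≡z c≢z
      ; _ (there (there (here refl))) _          → inj₂ refl }
      where
        two-step-shortest : IsShortest (e ∷ f ∷ [])
        two-step-shortest = shortest-if-no-shorter (e ∷ f ∷ []) λ
          { zero          _              []        → a≢b refl
          ; (suc zero)    _              (e′ ∷ []) → a≁b e′
          ; (suc (suc _)) (s≤s (s≤s ())) _ }

-- Cartesian products

module _ {G H : Graph} where

  □-walk-split : ∀ {g h g′ h′ m} → Walk (G □ H) (g , h) (g′ , h′) m →
                 ∃₂ λ k l → Walk G g g′ k × Walk H h h′ l × k + l ≡ m
  □-walk-split [] = 0 , 0 , [] , [] , refl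
  □-walk-split (_∷_ {y = _ , _} (inj₁ (e , refl)) w) with □-walk-split w
  ... | k , l , P , Q , k+l≡m = suc k , l , e ∷ P , Q , cong suc k+l≡m
  □-walk-split (_∷_ {y = _ , _} (inj₂ (refl , e)) w) with □-walk-split w
  ... | k , l , P , Q , k+l≡m = k , suc l , P , e ∷ Q , trans (+-suc k l) (cong suc k+l≡m)

  □-distance : ∀ {g h g′ h′ k l m} (P : Walk G g g′ k) (Q : Walk H h h′ l) →
               IsShortest P → IsShortest Q → Walk (G □ H) (g , h) (g′ , h′) m → k + l ≤ m
  □-distance _ _ P-shortest Q-shortest R with □-walk-split R
  ... | k′ , l′ , P′ , Q′ , refl = +-mono-≤ (P-shortest k′ P′) (Q-shortest l′ Q′)

  row : ∀ h {a b k} → Walk G a b k → Walk (G □ H) (a , h) (b , h) k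
  row h []      = []
  row h (e ∷ w) = inj₁ (e , refl) ∷ row h w

  ∈-verts-row : ∀ h {a b k v} (w : Walk G a b k) → v ∈ verts (row h w) →
                ∃ λ c → c ∈ verts w × v ≡ (c , h)
  ∈-verts-row h []      (here refl) = _ , here refl , refl
  ∈-verts-row h (e ∷ w) (here refl) = _ , here refl , refl
  ∈-verts-row h (e ∷ w) (there v∈)  with ∈-verts-row h w v∈
  ... | c , c∈w , refl = c , there c∈w , refl

module _ {G : Graph} {n : ℕ} where

  private
    GK = G □ Complete n
    rowK = row {G} {Complete n}

  columns : List (V G) → List (V GK)
  columns X = cartesianProduct X (allFin n)

  row-shortest : ∀ {a b k} h (P : Walk G a b k) → IsShortest P → IsShortest (rowK h P)
  row-shortest {k = k} h P P-shortest m R =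
    subst (_≤ m) (+-identityʳ k) (□-distance P [] P-shortest []-shortest R)

  across-shortest : ∀ {a b h g k} (P : Walk G a b k) → IsShortest P → (h≢g : h ≢ g) →
                    (R : Walk GK (a , h) (b , g) (suc k)) → IsShortest R
  across-shortest {k = k} P P-shortest h≢g _ m R =
    subst (_≤ m) (+-comm k 1) (□-distance P (h≢g ∷ []) P-shortest (edge-shortest h≢g h≢g) R)

  -- A geodesic of G lifted to a row changes row at an end column outside X:
  -- at b when a ∈ X, since then b ∉ X or b = a.
  columns-TMV : DecidableEquality (V G) → ∀ X → (∀ {a b} → a ∈ X → b ∈ X → a ≡ b) →
                IsTotalMutualVisibilitySet G X →
                IsTotalMutualVisibilitySet GK (columns X)
  columns-TMV _≟_ X X-subsingleton X-TMV (a , h) (b , g) with X-TMV a b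
  ... | k , P , P-shortest , P-avoids with h ≟Fin g
  ...   | yes refl = k , rowK h P , row-shortest h P P-shortest , avoids
    where
      avoids : ∀ v → v ∈ verts (rowK h P) → v ∈ columns X → v ≡ (a , h) ⊎ v ≡ (b , h)
      avoids v v∈R v∈col with ∈-verts-row h P v∈R
      ... | c , c∈P , refl with P-avoids c c∈P (proj₁ (∈-cartesianProduct⁻ X (allFin n) v∈col))
      ...   | inj₁ refl = inj₁ refl
      ...   | inj₂ refl = inj₂ refl
  ...   | no h≢g with Any.any? (a ≟_) X
  ...     | yes a∈X = suc k , R , across-shortest P P-shortest h≢g R , avoids
    where
      R = rowK h P ∷ʳ inj₂ (refl , h≢g)
      avoids : ∀ v → v ∈ verts R → v ∈ columns X → v ≡ (a , h) ⊎ v ≡ (b , g)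
      avoids v v∈R v∈col with ∈-verts-∷ʳ (rowK h P) (inj₂ (refl , h≢g)) v∈R
      ... | inj₂ v≡y = inj₂ v≡y
      ... | inj₁ v∈row with ∈-verts-row h P v∈row
      ...   | c , c∈P , refl with proj₁ (∈-cartesianProduct⁻ X (allFin n) v∈col)
      ...     | c∈X with P-avoids c c∈P c∈X
      ...       | inj₁ refl = inj₁ refl
      ...       | inj₂ refl = inj₁ (cong (_, h) (X-subsingleton c∈X a∈X))
  ...     | no a∉X = suc k , R , across-shortest P P-shortest h≢g R , avoids
    where
      R = inj₂ (refl , h≢g) ∷ rowK g P
      avoids : ∀ v → v ∈ verts R → v ∈ columns X → v ≡ (a , h) ⊎ v ≡ (b , g)
      avoids v (here refl) _ = inj₁ refl
      avoids v (there v∈row) v∈col with ∈-verts-row g P v∈row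
      ... | c , c∈P , refl with proj₁ (∈-cartesianProduct⁻ X (allFin n) v∈col)
      ...   | c∈X with P-avoids c c∈P c∈X
      ...     | inj₁ refl = contradiction c∈X a∉X
      ...     | inj₂ refl = inj₂ refl

  column-TMV-witness : DecidableEquality (V G) → ∀ z → IsTotalMutualVisibilitySet G (z ∷ []) →
                       Σ (List (V GK)) λ X → Unique X × IsTotalMutualVisibilitySet GK X × length X ≡ n
  column-TMV-witness _≟_ z z-TMV =
    columns (z ∷ []) ,
    Unique.cartesianProduct⁺ ([] ∷ []) (Unique.allFin⁺ n) ,
    columns-TMV _≟_ (z ∷ []) (λ { (here refl) (here refl) → refl }) z-TMV ,
    (begin
      length (map (z ,_) (allFin n) ++ []) ≡⟨ cong length (++-identityʳ (map (z ,_) (allFin n))) ⟩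
      length (map (z ,_) (allFin n))       ≡⟨ length-map (z ,_) (allFin n) ⟩
      length (allFin n)                    ≡⟨ length-tabulate id ⟩
      n                                    ∎)
    where open ≡-Reasoning

  row-blocks : ∀ {P : V GK → Set} {u w} h →
               Blocks {G} (λ c → P (c , h)) u w → Blocks {GK} P (u , h) (w , h)
  row-blocks {P} {u} {w} h (u≢w , u≁w , (c , e , f) , inP) =
    (λ uh≡wh → u≢w (cong proj₁ uh≡wh)) , not-adjacent ,
    ((c , h) , inj₁ (e , refl) , inj₁ (f , refl)) , inP′
    where
      not-adjacent : ¬ _~_ GK (u , h) (w , h)
      not-adjacent (inj₁ (e , _))   = u≁w e
      not-adjacent (inj₂ (_ , h≢h)) = h≢h refl
      inP′ : ∀ v → CommonNeighbour {GK} (u , h) (w , h) v → P v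
      inP′ (c , _) (inj₁ (e , refl)     , inj₁ (f , _))      = inP c (e , f)
      inP′ (c , _) (inj₁ (_ , refl)     , inj₂ (_ , h≢h))    = contradiction refl h≢h
      inP′ (c , _) (inj₂ (refl , h≢f)   , inj₁ (_ , f≡h))    = contradiction (sym f≡h) h≢f
      inP′ (c , _) (inj₂ (refl , _)     , inj₂ (u≡w , _))    = contradiction u≡w u≢w

  cross-blocks : ∀ {P : V GK → Set} {a b h g} → _~_ G a b → a ≢ b → h ≢ g →
                 P (a , h) → P (b , g) → Blocks {GK} P (a , g) (b , h)
  cross-blocks {P} {a} {b} {h} {g} e a≢b h≢g ah∈P bg∈P =
    (λ ag≡bh → a≢b (cong proj₁ ag≡bh)) , not-adjacent ,
    ((a , h) , inj₂ (refl , λ g≡h → h≢g (sym g≡h)) , inj₁ (e , refl)) , inP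
    where
      not-adjacent : ¬ _~_ GK (a , g) (b , h)
      not-adjacent (inj₁ (_ , g≡h)) = h≢g (sym g≡h)
      not-adjacent (inj₂ (a≡b , _)) = a≢b a≡b
      inP : ∀ v → CommonNeighbour {GK} (a , g) (b , h) v → P v
      inP _ (inj₁ (_ , refl)   , inj₁ (_ , g≡h))  = contradiction (sym g≡h) h≢g
      inP _ (inj₁ (_ , refl)   , inj₂ (refl , _)) = bg∈P
      inP _ (inj₂ (refl , _)   , inj₁ (_ , refl)) = ah∈P
      inP _ (inj₂ (refl , _)   , inj₂ (a≡b , _))  = contradiction a≡b a≢b

  confined-to-row : ∀ {X} → (∀ {c} → ¬ _~_ G c c) → IsTotalMutualVisibilitySet GK X →
                    ∀ {a b h} → (a , h) ∈ X → (b , h) ∈ X → Dominates {G} a b →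
                    ∀ {c f} → (c , f) ∈ X → f ≡ h
  confined-to-row {X} irrefl X-TMV {h = h} a∈X b∈X dominated {c} {f} c∈X with f ≟Fin h
  ... | yes f≡h = f≡h
  ... | no f≢h  = [ blocked a∈X , blocked b∈X ] (dominated c)
    where
      blocked : ∀ {d} → (d , h) ∈ X → _~_ G c d → f ≡ h
      blocked d∈X c~d = ⊥-elim (Blocks⇒¬Visible
        (cross-blocks c~d (λ { refl → irrefl c~d }) f≢h c∈X d∈X) (X-TMV _ _))

-- Cycles

module _ {s : ℕ} where

  CycNext? : ∀ i j → Dec (CycNext s i j)
  CycNext? i j = (toℕ i + 1 ≟ℕ toℕ j) ⊎-dec ((toℕ i + 1 ≟ℕ s) ×-dec (toℕ j ≟ℕ 0))

  cycle-adjacent? : Decidable (_~_ (Cycle s))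
  cycle-adjacent? i j = CycNext? i j ⊎-dec CycNext? j i

module _ {s : ℕ} .{{_ : NonZero s}} where

  private
    Adj = _~_ (Cycle s)

  shift : ℕ → Fin s → Fin s
  shift k i = (toℕ i + k) mod s

  toℕ-shift : ∀ k i → toℕ (shift k i) ≡ (toℕ i + k) % s
  toℕ-shift k i = toℕ-fromℕ< (m%n<n (toℕ i + k) s)

  shift-shift : ∀ k l i → shift l (shift k i) ≡ shift (k + l) i
  shift-shift k l i = toℕ-injective (begin
    toℕ (shift l (shift k i))        ≡⟨ toℕ-shift l (shift k i) ⟩
    (toℕ (shift k i) + l) % s        ≡⟨ cong (λ m → (m + l) % s) (toℕ-shift k i) ⟩
    ((toℕ i + k) % s + l) % s        ≡⟨ %-distribˡ-+ ((toℕ i + k) % s) l s ⟩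
    ((toℕ i + k) % s % s + l % s) % s ≡⟨ cong (λ m → (m + l % s) % s) (m%n%n≡m%n (toℕ i + k) s) ⟩
    ((toℕ i + k) % s + l % s) % s    ≡⟨ %-distribˡ-+ (toℕ i + k) l s ⟨
    (toℕ i + k + l) % s              ≡⟨ cong (_% s) (+-assoc (toℕ i) k l) ⟩
    (toℕ i + (k + l)) % s            ≡⟨ toℕ-shift (k + l) i ⟨
    toℕ (shift (k + l) i)            ∎)
    where open ≡-Reasoning

  shift-0 : ∀ i → shift 0 i ≡ i
  shift-0 i = toℕ-injective (begin
    toℕ (shift 0 i)    ≡⟨ toℕ-shift 0 i ⟩
    (toℕ i + 0) % s    ≡⟨ cong (_% s) (+-identityʳ (toℕ i)) ⟩
    toℕ i % s          ≡⟨ m<n⇒m%n≡m (toℕ<n i) ⟩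
    toℕ i              ∎)
    where open ≡-Reasoning

  shift-s : ∀ i → shift s i ≡ i
  shift-s i = toℕ-injective (begin
    toℕ (shift s i)    ≡⟨ toℕ-shift s i ⟩
    (toℕ i + s) % s    ≡⟨ [m+n]%n≡m%n (toℕ i) s ⟩
    toℕ i % s          ≡⟨ m<n⇒m%n≡m (toℕ<n i) ⟩
    toℕ i              ∎)
    where open ≡-Reasoning

  -- (i + k) mod s = i forces s ∣ k.
  shift-aperiodic : ∀ {k} i → 0 < k → k < s → shift k i ≢ i
  shift-aperiodic {k} i 0<k k<s shift≡i = multiple ((toℕ i + k) / s) k≡q*s
    where
      a = toℕ i
      [a+k]%s≡a : (a + k) % s ≡ a
      [a+k]%s≡a = trans (sym (toℕ-shift k i)) (cong toℕ shift≡i)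
      k≡q*s : k ≡ (a + k) / s * s
      k≡q*s = +-cancelˡ-≡ a k _ (begin
        a + k                         ≡⟨ m≡m%n+[m/n]*n (a + k) s ⟩
        (a + k) % s + (a + k) / s * s ≡⟨ cong (_+ (a + k) / s * s) [a+k]%s≡a ⟩
        a + (a + k) / s * s           ∎)
        where open ≡-Reasoning
      multiple : ∀ q → k ≢ q * s
      multiple zero    k≡0   = <⇒≢ 0<k (sym k≡0)
      multiple (suc q) k≡q*s = <⇒≱ k<s (subst (s ≤_) (sym k≡q*s) (m≤m+n s (q * s)))

  CycNext⇒≡shift : ∀ {i j} → CycNext s i j → j ≡ shift 1 i
  CycNext⇒≡shift {i} {j} (inj₁ i+1≡j) = toℕ-injective (begin
    toℕ j              ≡⟨ m<n⇒m%n≡m (toℕ<n j) ⟨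
    toℕ j % s          ≡⟨ cong (_% s) i+1≡j ⟨
    (toℕ i + 1) % s    ≡⟨ toℕ-shift 1 i ⟨
    toℕ (shift 1 i)    ∎)
    where open ≡-Reasoning
  CycNext⇒≡shift {i} {j} (inj₂ (i+1≡s , j≡0)) = toℕ-injective (begin
    toℕ j              ≡⟨ j≡0 ⟩
    0                  ≡⟨ n%n≡0 s ⟨
    s % s              ≡⟨ cong (_% s) i+1≡s ⟨
    (toℕ i + 1) % s    ≡⟨ toℕ-shift 1 i ⟨
    toℕ (shift 1 i)    ∎)
    where open ≡-Reasoning

  CycNext-shift : ∀ i → CycNext s i (shift 1 i)
  CycNext-shift i with m≤n⇒m<n∨m≡n (subst (_≤ s) (+-comm 1 (toℕ i)) (toℕ<n i))
  ... | inj₁ i+1<s = inj₁ (sym (trans (toℕ-shift 1 i) (m<n⇒m%n≡m i+1<s)))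
  ... | inj₂ i+1≡s = inj₂ (i+1≡s , trans (toℕ-shift 1 i) (trans (cong (_% s) i+1≡s) (n%n≡0 s)))

  adjacent⇒shift : ∀ {i j} → Adj i j → j ≡ shift 1 i ⊎ i ≡ shift 1 j
  adjacent⇒shift = Sum.map CycNext⇒≡shift CycNext⇒≡shift

  cycle-irreflexive : 1 < s → ∀ {i} → ¬ Adj i i
  cycle-irreflexive 1<s {i} i~i =
    shift-aperiodic i (s≤s z≤n) 1<s (sym ([ id , id ] (adjacent⇒shift i~i)))

  cycle-vertex-blocks : 5 ≤ s → ∀ i → ∃₂ λ u w → Blocks {Cycle s} (_≡ i) u w
  cycle-vertex-blocks 5≤s i = p , shift 2 p , p≢w , p≁w , (shift 1 p , p~p′ , p′~w) , middle
    where
      p = shift (s ∸ 1) i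
      1≤s = ≤-trans (s≤s z≤n) 5≤s
      aperiodic : ∀ {k} j → 0 < k → k ≤ 4 → shift k j ≢ j
      aperiodic j 0<k k≤4 = shift-aperiodic j 0<k (≤-trans (s≤s k≤4) 5≤s)
      p′≡i : shift 1 p ≡ i
      p′≡i = begin
        shift 1 (shift (s ∸ 1) i) ≡⟨ shift-shift (s ∸ 1) 1 i ⟩
        shift (s ∸ 1 + 1) i       ≡⟨ cong (λ k → shift k i) (m∸n+n≡m 1≤s) ⟩
        shift s i                 ≡⟨ shift-s i ⟩
        i                         ∎
        where open ≡-Reasoning
      p″≢p : shift 2 p ≢ p
      p″≢p = aperiodic p (s≤s z≤n) (s≤s (s≤s z≤n))
      p≢w : p ≢ shift 2 p
      p≢w p≡w = p″≢p (sym p≡w)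
      p~p′ : Adj p (shift 1 p)
      p~p′ = inj₁ (CycNext-shift p)
      p′~w : Adj (shift 1 p) (shift 2 p)
      p′~w = inj₁ (subst (CycNext s _) (shift-shift 1 1 p) (CycNext-shift (shift 1 p)))
      p≁w : ¬ Adj p (shift 2 p)
      p≁w p~w with adjacent⇒shift p~w
      ... | inj₁ w≡p′ = aperiodic (shift 1 p) (s≤s z≤n) (s≤s z≤n)
                          (trans (shift-shift 1 1 p) w≡p′)
      ... | inj₂ p≡w′ = aperiodic p (s≤s z≤n) (s≤s (s≤s (s≤s z≤n)))
                          (sym (trans p≡w′ (shift-shift 2 1 p)))
      middle : ∀ c → CommonNeighbour {Cycle s} p (shift 2 p) c → c ≡ i
      middle c (p~c , c~w) with adjacent⇒shift p~c | adjacent⇒shift c~w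
      ... | inj₁ c≡p′ | _         = trans c≡p′ p′≡i
      ... | inj₂ p≡c′ | inj₁ w≡c′ = contradiction (trans w≡c′ (sym p≡c′)) p″≢p
      ... | inj₂ p≡c′ | inj₂ c≡w′ = contradiction (sym p≡p⁗) (aperiodic p (s≤s z≤n) ≤-refl)
        where
          p≡p⁗ : p ≡ shift 4 p
          p≡p⁗ = begin
            p                         ≡⟨ p≡c′ ⟩
            shift 1 c                 ≡⟨ cong (shift 1) c≡w′ ⟩
            shift 1 (shift 1 (shift 2 p)) ≡⟨ cong (shift 1) (shift-shift 2 1 p) ⟩
            shift 1 (shift 3 p)       ≡⟨ shift-shift 3 1 p ⟩
            shift 4 p                 ∎
            where open ≡-Reasoning

  cycle-connected : ∀ a b → ∃ (Walk (Cycle s) a b)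
  cycle-connected a b = k , subst (λ b → Walk (Cycle s) a b k) shift-k≡b (walk-shift k a)
    where
      walk-shift : ∀ k i → Walk (Cycle s) i (shift k i) k
      walk-shift zero    i = subst (λ j → Walk (Cycle s) i j 0) (sym (shift-0 i)) []
      walk-shift (suc k) i = inj₁ (CycNext-shift i) ∷
        subst (λ j → Walk (Cycle s) (shift 1 i) j k) (shift-shift 1 k i) (walk-shift k (shift 1 i))
      k = toℕ b + (s ∸ toℕ a)
      a+[s∸a]≡s = m+[n∸m]≡n (<⇒≤ (toℕ<n a))
      shift-k≡b : shift k a ≡ b
      shift-k≡b = toℕ-injective (begin
        toℕ (shift k a)                   ≡⟨ toℕ-shift k a ⟩
        (toℕ a + (toℕ b + (s ∸ toℕ a))) % s ≡⟨ cong (_% s) (x∙yz≈y∙xz (toℕ a) (toℕ b) _) ⟩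
        (toℕ b + (toℕ a + (s ∸ toℕ a))) % s ≡⟨ cong (λ m → (toℕ b + m) % s) a+[s∸a]≡s ⟩
        (toℕ b + s) % s                   ≡⟨ [m+n]%n≡m%n (toℕ b) s ⟩
        toℕ b % s                         ≡⟨ m<n⇒m%n≡m (toℕ<n b) ⟩
        toℕ b                             ∎)
        where open ≡-Reasoning

module _ {s : ℕ} where

  private
    Adj = _~_ (Cycle s)

  common-neighbour? : ∀ u w c → Dec (CommonNeighbour {Cycle s} u w c)
  common-neighbour? u w c = cycle-adjacent? u c ×-dec cycle-adjacent? c w

  blocks? : ∀ {P : Fin s → Set} → (∀ c → Dec (P c)) → ∀ u w → Dec (Blocks {Cycle s} P u w)
  blocks? P? u w = ¬? (u ≟Fin w) ×-dec ¬? (cycle-adjacent? u w) ×-dec anyFin? (common-neighbour? u w)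
                   ×-dec allFin? (λ c → common-neighbour? u w c →-dec P? c)

  two-steps-avoiding? : ∀ z → Dec (TwoStepsAvoiding {Cycle s} z)
  two-steps-avoiding? z = allFin? λ a → allFin? λ b →
    ¬? (a ≟Fin b) →-dec (¬? (cycle-adjacent? a b) →-dec
    anyFin? λ c → common-neighbour? a b c ×-dec ¬? (c ≟Fin z))

  edges-dominate? : Dec (∀ a b → Adj a b → Dominates {Cycle s} a b)
  edges-dominate? = allFin? λ a → allFin? λ b → cycle-adjacent? a b →-dec
                    allFin? λ c → cycle-adjacent? c a ⊎-dec cycle-adjacent? c b

-- Finite facts decided by evaluation; opaque so that the decision procedures are
-- never unfolded where the facts are used.
module C₃ where

  opaque

    complete : ∀ a b → a ≢ b → _~_ (Cycle 3) a b
    complete = from-yes (allFin? λ a → allFin? λ b → ¬? (a ≟Fin b) →-dec cycle-adjacent? {3} a b)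

    edges-dominate : ∀ a b → _~_ (Cycle 3) a b → Dominates {Cycle 3} a b
    edges-dominate = from-yes (edges-dominate? {3})

    zero-avoidable : TwoStepsAvoiding {Cycle 3} zero
    zero-avoidable = from-yes (two-steps-avoiding? {3} zero)

module C₄ where

  opaque

    edges-dominate : ∀ a b → _~_ (Cycle 4) a b → Dominates {Cycle 4} a b
    edges-dominate = from-yes (edges-dominate? {4})

    zero-avoidable : TwoStepsAvoiding {Cycle 4} zero
    zero-avoidable = from-yes (two-steps-avoiding? {4} zero)

    triangle-free : ∀ a b c → _~_ (Cycle 4) a b → _~_ (Cycle 4) b c → ¬ _~_ (Cycle 4) c a
    triangle-free = from-yes (allFin? λ a → allFin? λ b → allFin? λ c →
      cycle-adjacent? {4} a b →-dec (cycle-adjacent? {4} b c →-dec ¬? (cycle-adjacent? {4} c a)))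

    antipodes-blocked : ∀ a b → a ≢ b → ¬ _~_ (Cycle 4) a b →
                        ∃₂ λ u w → Blocks {Cycle 4} (λ c → c ≡ a ⊎ c ≡ b) u w
    antipodes-blocked = from-yes (allFin? λ a → allFin? λ b →
      ¬? (a ≟Fin b) →-dec (¬? (cycle-adjacent? {4} a b) →-dec
      anyFin? λ u → anyFin? λ w → blocks? {4} (λ c → (c ≟Fin a) ⊎-dec (c ≟Fin b)) u w))

MuT[Cₛ□Kₙ]≡0 : ∀ {s} n → 5 ≤ s → MuT≡ (Cycle s □ Complete n) 0
MuT[Cₛ□Kₙ]≡0 {s} n 5≤s = ([] , [] , empty-TMV , refl) , only-empty
  where
    instance
      s≢0 : NonZero s
      s≢0 = >-nonZero (≤-trans (s≤s z≤n) 5≤s)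
    empty-TMV : IsTotalMutualVisibilitySet (Cycle s □ Complete n) []
    empty-TMV = columns-TMV _≟Fin_ [] (λ ())
      (connected⇒[]-TMV _≟Fin_ cycle-adjacent? (allFin s) ∈-allFin cycle-connected)
    only-empty : ∀ X → Unique X → IsTotalMutualVisibilitySet (Cycle s □ Complete n) X → length X ≤ 0
    only-empty []             _ _     = z≤n
    only-empty ((i , h) ∷ X) _ X-TMV with cycle-vertex-blocks 5≤s i
    ... | _ , _ , blocked = ⊥-elim (Blocks⇒¬Visible
          (row-blocks h (Blocks-mono (λ { refl → here refl }) blocked)) (X-TMV _ _))

MuT[C₃□Kₙ]≡n : ∀ n → 3 ≤ n → MuT≡ (Cycle 3 □ Complete n) n
MuT[C₃□Kₙ]≡n n 3≤n =
  column-TMV-witness _≟Fin_ zero (singleton-TMV _≟Fin_ cycle-adjacent? zero C₃.zero-avoidable) , at-most-n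
  where
    at-most-n : ∀ X → Unique X → IsTotalMutualVisibilitySet (Cycle 3 □ Complete n) X → length X ≤ n
    at-most-n X X! X-TMV with length≤n-or-row-collision X X!
    ... | inj₁ |X|≤n = |X|≤n
    ... | inj₂ (a , b , h , a≢b , a∈X , b∈X) = ≤-trans (Unique-⊆⇒length-≤ X! X⊆row) 3≤n
      where
        X⊆row : X ⊆ cartesianProduct (allFin 3) (h ∷ [])
        X⊆row {c , f} c∈X with confined-to-row (cycle-irreflexive (s≤s (s≤s z≤n))) X-TMV a∈X b∈X
                                 (C₃.edges-dominate a b (C₃.complete a b a≢b)) c∈X
        ... | refl = ∈-cartesianProduct⁺ {xs = allFin 3} {ys = h ∷ []} (∈-allFin c) (here refl)

MuT[C₄□Kₙ]≡n : ∀ n → 3 ≤ n → MuT≡ (Cycle 4 □ Complete n) n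
MuT[C₄□Kₙ]≡n n 3≤n =
  column-TMV-witness _≟Fin_ zero (singleton-TMV _≟Fin_ cycle-adjacent? zero C₄.zero-avoidable) , at-most-n
  where
    at-most-n : ∀ X → Unique X → IsTotalMutualVisibilitySet (Cycle 4 □ Complete n) X → length X ≤ n
    at-most-n X X! X-TMV with length≤n-or-row-collision X X!
    ... | inj₁ |X|≤n = |X|≤n
    ... | inj₂ (a , b , h , a≢b , a∈X , b∈X) =
          ≤-trans (Unique-⊆⇒length-≤ X! X⊆ab) (≤-trans (n≤1+n 2) 3≤n)
      where
        same-row-adjacent : ∀ {c d} → (c , h) ∈ X → (d , h) ∈ X → c ≢ d → _~_ (Cycle 4) c d
        same-row-adjacent {c} {d} c∈X d∈X c≢d with cycle-adjacent? c d
        ... | yes c~d = c~d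
        ... | no c≁d with C₄.antipodes-blocked c d c≢d c≁d
        ...   | _ , _ , blocked = ⊥-elim (Blocks⇒¬Visible
                  (row-blocks h (Blocks-mono [ (λ { refl → c∈X }) , (λ { refl → d∈X }) ] blocked))
                  (X-TMV _ _))
        a~b = same-row-adjacent a∈X b∈X a≢b
        X⊆ab : X ⊆ (a , h) ∷ (b , h) ∷ []
        X⊆ab {c , f} c∈X with confined-to-row (cycle-irreflexive (s≤s (s≤s z≤n))) X-TMV a∈X b∈X
                                (C₄.edges-dominate a b a~b) c∈X
        ... | refl with c ≟Fin a | c ≟Fin b
        ...   | yes refl | _        = here refl
        ...   | no _     | yes refl = there (here refl)
        ...   | no c≢a   | no c≢b   = ⊥-elim (C₄.triangle-free a b c a~b
                  (same-row-adjacent b∈X c∈X λ { refl → c≢b refl })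
                  (same-row-adjacent c∈X a∈X c≢a))

proposition4p4 : (s n : ℕ) → 3 ≤ s → 3 ≤ n →
    (5 ≤ s → MuT≡ (Cycle s □ Complete n) 0) ×
    (s ≤ 4 → MuT≡ (Cycle s □ Complete n) n)
proposition4p4 3 n _ 3≤n = (λ { (s≤s (s≤s (s≤s ()))) }) , λ _ → MuT[C₃□Kₙ]≡n n 3≤n
proposition4p4 4 n _ 3≤n = (λ { (s≤s (s≤s (s≤s (s≤s ())))) }) , λ _ → MuT[C₄□Kₙ]≡n n 3≤n
proposition4p4 (suc (suc (suc (suc (suc s))))) n _ _ =
  MuT[Cₛ□Kₙ]≡0 n , λ { (s≤s (s≤s (s≤s (s≤s ())))) }
proposition4p4 0 n () _
proposition4p4 1 n (s≤s ()) _
proposition4p4 2 n (s≤s (s≤s ())) _
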